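{- For every SP-game $G$, the formal birthday of $G$ satisfies $\widetilde{b}(G)=\dim(\Delta_G)+1$.
   Context: All games are two-player (Left and Right) short combinatorial games under normal play. A strong placement game (SP-game) is a combinatorial game such that: (i) the board is empty at the beginning; (ii) players place pieces on empty vertices of the board according to the rules; (iii) pieces are never moved or removed once placed; (iv) if a position can be reached through some sequence of legal moves, then any sequence of moves leading to this position consists of legal moves. A basic position is a position with a single piece played. The legal complex $\Delta_G$ is the simplicial complex with one vertex per basic position (Left basic positions $x_i$, Right basic positions $y_j$) whose faces are the sets of vertices whose corresponding basic positions together form a legal position. The dimension of a face is its size minus one; $\dim(\Delta)$ is the maximum dimension of a face (the empty complex $\{\emptyset\}$ has dimension $-1$). Let $\widetilde{\mathbb{G}}_0=\{0\}$ with $0=\{\,\mid\,\}$ and $\widetilde{\mathbb{G}}_{n+1}=\{\{A\mid B\}: A,B\subseteq\widetilde{\mathbb{G}}_n\}$ (games in literal form). The formal birthday $\widetilde{b}(G)$ is the least $n$ with the literal form of $G$ in $\widetilde{\mathbb{G}}_n$, i.e. the height of the game tree of $G$ (maximum number of moves from the start to an end position). -}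

module Defs where

open import Data.Nat using (ℕ; zero; suc; _+_; _⊔_; _≤_)
open import Data.Integer as ℤ using (ℤ; +_)
open import Data.Bool using (Bool; true; false; if_then_else_)
open import Data.Fin using (Fin)
open import Data.Fin.Subset using (Subset; _∈_; ∣_∣)
open import Data.Maybe using (Maybe; just; nothing)
open import Data.List using (List; []; _∷_; mapMaybe; allFin)
open import Data.Vec using (Vec; lookup; replicate; tabulate; _[_]≔_)
open import Data.Product using (_×_; _,_; Σ; ∃)
open import Relation.Nullary using (Dec; yes; no; ¬_)
open import Relation.Binary.PropositionalEquality using (_≡_)

data Game : Set where
  ⟨_∣_⟩ : List Game → List Game → Game

mutual
  formalBirthday : Game → ℕ
  formalBirthday ⟨ [] ∣ [] ⟩ = 0
  formalBirthday ⟨ A ∣ B ⟩ = suc (maxB A ⊔ maxB B)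

  maxB : List Game → ℕ
  maxB [] = 0
  maxB (g ∷ gs) = formalBirthday g ⊔ maxB gs

data Player : Set where
  left right : Player

Position : ℕ → Set
Position n = Vec (Maybe Player) n

emptyBoard : (n : ℕ) → Position n
emptyBoard n = replicate n nothing

Move : ℕ → Set
Move n = Fin n × Player

data Placements {n : ℕ} : Position n → List (Move n) → Position n → Set where
  done : ∀ {P} → Placements P [] P
  step : ∀ {P Q v c ms} → lookup P v ≡ nothing →
         Placements (P [ v ]≔ just c) ms Q → Placements P ((v , c) ∷ ms) Q

Rules : ℕ → Set₁
Rules n = Position n → Fin n → Player → Set

data LegalSeq {n : ℕ} (Rule : Rules n) : Position n → List (Move n) → Position n → Set where
  done : ∀ {P} → LegalSeq Rule P [] P
  step : ∀ {P Q v c ms} → lookup P v ≡ nothing → Rule P v c →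
         LegalSeq Rule (P [ v ]≔ just c) ms Q → LegalSeq Rule P ((v , c) ∷ ms) Q

LegalPos : {n : ℕ} → Rules n → Position n → Set
LegalPos {n} Rule Q = ∃ λ ms → LegalSeq Rule (emptyBoard n) ms Q

-- Strong placement games (board initially empty; pieces placed on empty
-- vertices, never moved or removed; condition (iv) is the field strong).

record SPGame : Set₁ where
  field
    n       : ℕ
    Rule    : Rules n
    rule?   : ∀ P v c → Dec (Rule P v c)
    strong  : ∀ Q → LegalPos Rule Q → ∀ ms → Placements (emptyBoard n) ms Q →
              LegalSeq Rule (emptyBoard n) ms Q

  Legal : Position n → Set
  Legal = LegalPos Rule

open SPGame public

-- Each move fills an empty vertex, so at most n moves are ever
-- possible; fuel n therefore never truncates the tree.

module _ (G : SPGame) where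
  private N = n G

  isEmpty? : (P : Position N) (v : Fin N) → Dec (lookup P v ≡ nothing)
  isEmpty? P v with lookup P v
  ... | nothing = yes _≡_.refl
  ... | just _  = no λ ()

  mutual
    gameAt : ℕ → Position N → Game
    gameAt zero    P = ⟨ [] ∣ [] ⟩
    gameAt (suc k) P = ⟨ options k P left ∣ options k P right ⟩

    options : ℕ → Position N → Player → List Game
    options k P c = mapMaybe (opt k P c) (allFin N)

    opt : ℕ → Position N → Player → Fin N → Maybe Game
    opt k P c v with isEmpty? P v | rule? G P v c
    ... | yes _ | yes _ = just (gameAt k (P [ v ]≔ just c))
    ... | _     | _     = nothing

  toGame : Game
  toGame = gameAt N (emptyBoard N)

-- Vertices: basic positions x_v (Left piece on v)
-- and y_v (Right piece on v) that are legal.  A set of vertices is given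
-- by a pair (X , Y) of subsets of the board: X = {v | x_v in the set},
-- Y = {v | y_v in the set}.

  basic : Fin N → Player → Position N
  basic v c = emptyBoard N [ v ]≔ just c

  IsVertexΔ : Fin N → Player → Set
  IsVertexΔ v c = Legal G (basic v c)

  positionOf : Subset N → Subset N → Position N
  positionOf X Y = tabulate λ v →
    if lookup X v then just left else (if lookup Y v then just right else nothing)

  FaceΔ : Subset N → Subset N → Set
  FaceΔ X Y =
    (∀ v → v ∈ X → IsVertexΔ v left) ×
    (∀ v → v ∈ Y → IsVertexΔ v right) ×
    (∀ v → v ∈ X → ¬ (v ∈ Y)) ×
    Legal G (positionOf X Y)

  faceSize : Subset N → Subset N → ℕ
  faceSize X Y = ∣ X ∣ + ∣ Y ∣

  DimΔ : ℤ → Set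
  DimΔ d =
    (Σ (Subset N) λ X → Σ (Subset N) λ Y →
       FaceΔ X Y × (+ faceSize X Y) ℤ.- ℤ.1ℤ ≡ d) ×
    (∀ X Y → FaceΔ X Y → (+ faceSize X Y) ℤ.- ℤ.1ℤ ℤ.≤ d)

module Submission where

-- The formal birthday of the game tree rooted at a position P is the length of the longest
-- sequence of legal moves from P: every such sequence runs down the tree, and a branch of
-- maximal height is such a sequence.  From the empty board, a legal sequence of length m
-- reaches a legal position with m pieces; by condition (iv) each of its pieces may be played
-- first, so its pieces form a face of Δ_G with m vertices.  Conversely a face is a legal
-- position, so it is reached by a legal sequence with one move per vertex of the face.

open import Defs
open import Data.Integer using (ℤ; +_; _-_; 1ℤ)
import Data.Integer as ℤ
import Data.Integer.Properties as ℤ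
open import Data.Nat using (ℕ; zero; suc; _+_; _⊔_; _≤_; _<_; z≤n; s≤s)
open import Data.Nat.Properties
  using (≤-trans; m≤m⊔n; m≤n⊔m; ⊔-sel; ⊔-assoc; ⊔-identityʳ; +-identityʳ; +-suc; n≤1+n)
open import Data.Bool using (Bool; true; false; if_then_else_)
open import Data.Fin using (zero; suc)
open import Data.Fin.Subset using (Subset; _∈_; ∣_∣)
open import Data.Maybe using (Maybe; just; nothing)
open import Data.List using (List; []; _∷_; _++_; mapMaybe; allFin; length)
import Data.List as List
open import Data.List.Membership.Propositional using () renaming (_∈_ to _∈ˡ_)
open import Data.List.Membership.Propositional.Properties using (∈-allFin; ∈-++⁺ˡ; ∈-++⁺ʳ; ∈-++⁻)
open import Data.List.Relation.Unary.Any using (here; there)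
open import Data.Vec using ([]; _∷_; lookup; tabulate; _[_]≔_; here; there)
import Data.Vec as Vec
open import Data.Vec.Properties using ([]=⇒lookup; lookup-map; lookup-replicate)
open import Data.Vec.Relation.Binary.Pointwise.Inductive using (Pointwise; []; _∷_)
open import Data.Product using (_×_; _,_; Σ-syntax; ∃; ∃₂; map₁)
open import Data.Sum using (_⊎_; inj₁; inj₂)
open import Data.Empty using (⊥-elim)
open import Relation.Nullary using (yes; no; ¬_)
open import Relation.Binary.PropositionalEquality

maxB-upper : ∀ {g gs} → g ∈ˡ gs → formalBirthday g ≤ maxB gs
maxB-upper {g} {_ ∷ gs} (here refl) = m≤m⊔n (formalBirthday g) (maxB gs)
maxB-upper {_} {x ∷ gs} (there g∈gs) = ≤-trans (maxB-upper g∈gs) (m≤n⊔m (formalBirthday x) (maxB gs))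

maxB-attained : ∀ {g gs} → g ∈ˡ gs → ∃ λ h → h ∈ˡ gs × formalBirthday h ≡ maxB gs
maxB-attained {gs = x ∷ []} _ = x , here refl , sym (⊔-identityʳ _)
maxB-attained {gs = x ∷ y ∷ gs} _
  with ⊔-sel (formalBirthday x) (maxB (y ∷ gs)) | maxB-attained {gs = y ∷ gs} (here refl)
... | inj₁ x-max    | _ = x , here refl , sym x-max
... | inj₂ rest-max | h , h∈ , h-max = h , there h∈ , trans h-max (sym rest-max)

maxB-++ : ∀ A B → maxB (A ++ B) ≡ maxB A ⊔ maxB B
maxB-++ [] B = refl
maxB-++ (a ∷ A) B = trans (cong (formalBirthday a ⊔_) (maxB-++ A B)) (sym (⊔-assoc _ (maxB A) (maxB B)))

formalBirthday-⟨∣⟩ : ∀ {g} A B → g ∈ˡ A ++ B → formalBirthday ⟨ A ∣ B ⟩ ≡ suc (maxB (A ++ B))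
formalBirthday-⟨∣⟩ [] (_ ∷ _) _ = refl
formalBirthday-⟨∣⟩ (a ∷ A) B _ = cong suc (sym (maxB-++ (a ∷ A) B))

formalBirthday-option : ∀ {g} A B → g ∈ˡ A ++ B → formalBirthday g < formalBirthday ⟨ A ∣ B ⟩
formalBirthday-option A B g∈ rewrite formalBirthday-⟨∣⟩ A B g∈ = s≤s (maxB-upper g∈)

formalBirthday-highest : ∀ {g} A B → g ∈ˡ A ++ B →
  ∃ λ h → h ∈ˡ A ++ B × formalBirthday ⟨ A ∣ B ⟩ ≡ suc (formalBirthday h)
formalBirthday-highest A B g∈ with maxB-attained g∈
... | h , h∈ , h-max = h , h∈ , trans (formalBirthday-⟨∣⟩ A B g∈) (cong suc (sym h-max))

formalBirthday-attained : ∀ A B → formalBirthday ⟨ A ∣ B ⟩ ≡ 0 ⊎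
  ∃ λ g → g ∈ˡ A ++ B × formalBirthday ⟨ A ∣ B ⟩ ≡ suc (formalBirthday g)
formalBirthday-attained [] [] = inj₁ refl
formalBirthday-attained [] B@(_ ∷ _) = inj₂ (formalBirthday-highest [] B (here refl))
formalBirthday-attained A@(_ ∷ _) B = inj₂ (formalBirthday-highest A B (here refl))

module _ {A B : Set} {f : A → Maybe B} where

  mapMaybe-∈⁺ : ∀ {x y xs} → x ∈ˡ xs → f x ≡ just y → y ∈ˡ mapMaybe f xs
  mapMaybe-∈⁺ {xs = x ∷ _} (here refl) fx≡y rewrite fx≡y = here refl
  mapMaybe-∈⁺ {xs = x ∷ _} (there x∈) fx≡y with f x
  ... | nothing = mapMaybe-∈⁺ x∈ fx≡y
  ... | just _  = there (mapMaybe-∈⁺ x∈ fx≡y)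

  mapMaybe-∈⁻ : ∀ {y} xs → y ∈ˡ mapMaybe f xs → ∃ λ x → f x ≡ just y
  mapMaybe-∈⁻ (x ∷ xs) y∈ with f x in fx≡
  ... | nothing = mapMaybe-∈⁻ xs y∈
  ... | just _ with y∈
  ...   | here refl = x , fx≡
  ...   | there y∈′ = mapMaybe-∈⁻ xs y∈′

pieces : ∀ {n} → Position n → ℕ
pieces [] = 0
pieces (nothing ∷ P) = pieces P
pieces (just _ ∷ P) = suc (pieces P)

pieces-place : ∀ {n} (P : Position n) v c → lookup P v ≡ nothing →
  pieces (P [ v ]≔ just c) ≡ suc (pieces P)
pieces-place (nothing ∷ P) zero c refl = refl
pieces-place (nothing ∷ P) (suc v) c empty = pieces-place P v c empty
pieces-place (just _ ∷ P) (suc v) c empty = cong suc (pieces-place P v c empty)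

pieces≤size : ∀ {n} (P : Position n) → pieces P ≤ n
pieces≤size [] = z≤n
pieces≤size (nothing ∷ P) = ≤-trans (pieces≤size P) (n≤1+n _)
pieces≤size (just _ ∷ P) = s≤s (pieces≤size P)

pieces-emptyBoard : ∀ n → pieces (emptyBoard n) ≡ 0
pieces-emptyBoard zero = refl
pieces-emptyBoard (suc n) = pieces-emptyBoard n

length+pieces : ∀ {n} {R : Rules n} {P ms Q} → LegalSeq R P ms Q → length ms + pieces P ≡ pieces Q
length+pieces done = refl
length+pieces {P = P} (step {v = v} {c} {ms} empty _ s) = begin
  suc (length ms + pieces P)           ≡⟨ +-suc (length ms) (pieces P) ⟨
  length ms + suc (pieces P)           ≡⟨ cong (λ p → length ms + p) (pieces-place P v c empty) ⟨
  length ms + pieces (P [ v ]≔ just c) ≡⟨ length+pieces s ⟩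
  _                                    ∎
  where open ≡-Reasoning

length≡pieces : ∀ {n} {R : Rules n} {ms Q} → LegalSeq R (emptyBoard n) ms Q → length ms ≡ pieces Q
length≡pieces {n} {ms = ms} {Q} s = begin
  length ms                           ≡⟨ +-identityʳ (length ms) ⟨
  length ms + 0                       ≡⟨ cong (λ p → length ms + p) (pieces-emptyBoard n) ⟨
  length ms + pieces (emptyBoard n)   ≡⟨ length+pieces s ⟩
  pieces Q                            ∎
  where open ≡-Reasoning

-- positionOf from Defs, for a board of any size
fromSubsets : ∀ {n} → Subset n → Subset n → Position n
fromSubsets X Y = tabulate λ v →
  if lookup X v then just left else (if lookup Y v then just right else nothing)

Disjoint : ∀ {n} → Subset n → Subset n → Set
Disjoint X Y = ∀ v → v ∈ X → ¬ (v ∈ Y)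

disjoint-tail : ∀ {n x y} {X Y : Subset n} → Disjoint (x ∷ X) (y ∷ Y) → Disjoint X Y
disjoint-tail disj v v∈X v∈Y = disj (suc v) (there v∈X) (there v∈Y)

pieces-fromSubsets : ∀ {n} (X Y : Subset n) → Disjoint X Y → pieces (fromSubsets X Y) ≡ ∣ X ∣ + ∣ Y ∣
pieces-fromSubsets [] [] _ = refl
pieces-fromSubsets (true ∷ X) (true ∷ Y) disj = ⊥-elim (disj zero here here)
pieces-fromSubsets (true ∷ X) (false ∷ Y) disj = cong suc (pieces-fromSubsets X Y (disjoint-tail disj))
pieces-fromSubsets (false ∷ X) (true ∷ Y) disj =
  trans (cong suc (pieces-fromSubsets X Y (disjoint-tail disj))) (sym (+-suc ∣ X ∣ ∣ Y ∣))
pieces-fromSubsets (false ∷ X) (false ∷ Y) disj = pieces-fromSubsets X Y (disjoint-tail disj)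

occupies : Player → Maybe Player → Bool
occupies left  (just left)  = true
occupies right (just right) = true
occupies _     _            = false

occupies⇒≡ : ∀ c q → occupies c q ≡ true → q ≡ just c
occupies⇒≡ left  (just left)  _ = refl
occupies⇒≡ right (just right) _ = refl

owned : ∀ {n} → Player → Position n → Subset n
owned c = Vec.map (occupies c)

owned-lookup : ∀ {n} c (Q : Position n) {v} → v ∈ owned c Q → lookup Q v ≡ just c
owned-lookup c Q {v} v∈ = occupies⇒≡ c (lookup Q v) (trans (sym (lookup-map v (occupies c) Q)) ([]=⇒lookup v∈))

owned-disjoint : ∀ {n} (Q : Position n) → Disjoint (owned left Q) (owned right Q)
owned-disjoint Q v v∈L v∈R with trans (sym (owned-lookup left Q v∈L)) (owned-lookup right Q v∈R)
... | ()

fromSubsets-owned : ∀ {n} (Q : Position n) → fromSubsets (owned left Q) (owned right Q) ≡ Q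
fromSubsets-owned [] = refl
fromSubsets-owned (nothing ∷ Q) = cong (nothing ∷_) (fromSubsets-owned Q)
fromSubsets-owned (just left ∷ Q) = cong (just left ∷_) (fromSubsets-owned Q)
fromSubsets-owned (just right ∷ Q) = cong (just right ∷_) (fromSubsets-owned Q)

data _≼_ : Maybe Player → Maybe Player → Set where
  empty≼ : ∀ {q} → nothing ≼ q
  refl≼  : ∀ {q} → q ≼ q

_⊑_ : ∀ {n} → Position n → Position n → Set
_⊑_ = Pointwise _≼_

emptyBoard-⊑ : ∀ {n} (Q : Position n) → emptyBoard n ⊑ Q
emptyBoard-⊑ [] = []
emptyBoard-⊑ (_ ∷ Q) = empty≼ ∷ emptyBoard-⊑ Q

single-⊑ : ∀ {n} (Q : Position n) v {c} → lookup Q v ≡ just c → (emptyBoard n [ v ]≔ just c) ⊑ Q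
single-⊑ (_ ∷ Q) zero refl = refl≼ ∷ emptyBoard-⊑ Q
single-⊑ (_ ∷ Q) (suc v) Qv≡c = empty≼ ∷ single-⊑ Q v Qv≡c

placements-∷ : ∀ {n} {P Q : Position n} {ms} q → Placements P ms Q →
  Placements (q ∷ P) (List.map (map₁ suc) ms) (q ∷ Q)
placements-∷ q done = done
placements-∷ q (step empty pl) = step empty (placements-∷ q pl)

⊑⇒placements : ∀ {n} {P Q : Position n} → P ⊑ Q → ∃ λ ms → Placements P ms Q
⊑⇒placements [] = [] , done
⊑⇒placements (refl≼ {q} ∷ P⊑Q) with ⊑⇒placements P⊑Q
... | _ , pl = _ , placements-∷ q pl
⊑⇒placements (empty≼ {nothing} ∷ P⊑Q) with ⊑⇒placements P⊑Q
... | _ , pl = _ , placements-∷ nothing pl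
⊑⇒placements (empty≼ {just c} ∷ P⊑Q) with ⊑⇒placements P⊑Q
... | _ , pl = _ , step {v = zero} refl (placements-∷ (just c) pl)

module _ (G : SPGame) where
  private N = n G

  opt-just⁻ : ∀ {k P c v g} → opt G k P c v ≡ just g →
    lookup P v ≡ nothing × Rule G P v c × g ≡ gameAt G k (P [ v ]≔ just c)
  opt-just⁻ {k} {P} {c} {v} o with isEmpty? G P v | rule? G P v c
  opt-just⁻ refl | yes empty | yes legal = empty , legal , refl
  opt-just⁻ ()   | yes _     | no _
  opt-just⁻ ()   | no _      | _

  opt-just⁺ : ∀ {k P c v} → lookup P v ≡ nothing → Rule G P v c →
    opt G k P c v ≡ just (gameAt G k (P [ v ]≔ just c))
  opt-just⁺ {k} {P} {c} {v} empty legal with isEmpty? G P v | rule? G P v c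
  ... | yes _ | yes _     = refl
  ... | yes _ | no ¬legal = ⊥-elim (¬legal legal)
  ... | no ¬empty | _     = ⊥-elim (¬empty empty)

  moves : ℕ → Position N → List Game
  moves k P = options G k P left ++ options G k P right

  move∈options : ∀ {k P v c} → lookup P v ≡ nothing → Rule G P v c →
    gameAt G k (P [ v ]≔ just c) ∈ˡ options G k P c
  move∈options {k} {P} {v} {c} empty legal = mapMaybe-∈⁺ {f = opt G k P c} (∈-allFin v) (opt-just⁺ empty legal)

  move∈moves : ∀ {k P v} c → lookup P v ≡ nothing → Rule G P v c →
    gameAt G k (P [ v ]≔ just c) ∈ˡ moves k P
  move∈moves left  empty legal = ∈-++⁺ˡ (move∈options empty legal)
  move∈moves {k} {P} right empty legal = ∈-++⁺ʳ (options G k P left) (move∈options empty legal)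

  ∈options⇒move : ∀ {k P c g} → g ∈ˡ options G k P c →
    ∃ λ v → lookup P v ≡ nothing × Rule G P v c × g ≡ gameAt G k (P [ v ]≔ just c)
  ∈options⇒move {k} {P} {c} g∈ with mapMaybe-∈⁻ {f = opt G k P c} (allFin N) g∈
  ... | v , o = v , opt-just⁻ o

  ∈moves⇒move : ∀ {k P g} → g ∈ˡ moves k P →
    ∃₂ λ c v → lookup P v ≡ nothing × Rule G P v c × g ≡ gameAt G k (P [ v ]≔ just c)
  ∈moves⇒move {k} {P} g∈ with ∈-++⁻ (options G k P left) g∈
  ... | inj₁ g∈L = left , ∈options⇒move g∈L
  ... | inj₂ g∈R = right , ∈options⇒move g∈R

  length≤formalBirthday : ∀ {k P ms Q} → LegalSeq (Rule G) P ms Q → length ms ≤ k →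
    length ms ≤ formalBirthday (gameAt G k P)
  length≤formalBirthday done _ = z≤n
  length≤formalBirthday {suc k} {P} (step {c = c} empty legal s) (s≤s ms≤k) =
    ≤-trans (s≤s (length≤formalBirthday s ms≤k))
            (formalBirthday-option (options G k P left) (options G k P right) (move∈moves c empty legal))

  formalBirthday-realised : ∀ k P →
    Σ[ ms ∈ List (Move N) ] Σ[ Q ∈ Position N ] LegalSeq (Rule G) P ms Q × length ms ≡ formalBirthday (gameAt G k P)
  formalBirthday-realised zero P = [] , P , done , refl
  formalBirthday-realised (suc k) P with formalBirthday-attained (options G k P left) (options G k P right)
  ... | inj₁ b≡0 = [] , P , done , sym b≡0
  ... | inj₂ (g , g∈ , b≡) with ∈moves⇒move g∈
  ...   | c , v , empty , legal , refl with formalBirthday-realised k (P [ v ]≔ just c)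
  ...     | ms , Q , s , len = (v , c) ∷ ms , Q , step empty legal s , trans (cong suc len) (sym b≡)

  -- By condition (iv) the piece on v may be placed first on the way to Q.
  legal⇒vertex : ∀ {Q} → Legal G Q → ∀ {v c} → lookup Q v ≡ just c → IsVertexΔ G v c
  legal⇒vertex {Q} legalQ {v} {c} Qv≡c with ⊑⇒placements (single-⊑ Q v Qv≡c)
  ... | ms , pl with strong G Q legalQ ((v , c) ∷ ms) (step (lookup-replicate v nothing) pl)
  ...   | step empty legal _ = (v , c) ∷ [] , step empty legal done

  legal⇒face : ∀ {Q} → Legal G Q → FaceΔ G (owned left Q) (owned right Q)
  legal⇒face {Q} legalQ =
    (λ v v∈ → legal⇒vertex legalQ (owned-lookup left Q v∈)) ,
    (λ v v∈ → legal⇒vertex legalQ (owned-lookup right Q v∈)) ,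
    owned-disjoint Q ,
    subst (Legal G) (sym (fromSubsets-owned Q)) legalQ

  faceSize-owned : ∀ (Q : Position N) → faceSize G (owned left Q) (owned right Q) ≡ pieces Q
  faceSize-owned Q =
    trans (sym (pieces-fromSubsets (owned left Q) (owned right Q) (owned-disjoint Q)))
          (cong pieces (fromSubsets-owned Q))

  face-of-size-formalBirthday : Σ[ X ∈ Subset N ] Σ[ Y ∈ Subset N ] FaceΔ G X Y × faceSize G X Y ≡ formalBirthday (toGame G)
  face-of-size-formalBirthday with formalBirthday-realised N (emptyBoard N)
  ... | ms , Q , s , len =
    owned left Q , owned right Q , legal⇒face (ms , s) ,
    trans (faceSize-owned Q) (trans (sym (length≡pieces s)) len)

  faceSize≤formalBirthday : ∀ {X Y} → FaceΔ G X Y → faceSize G X Y ≤ formalBirthday (toGame G)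
  faceSize≤formalBirthday {X} {Y} (_ , _ , disj , ms , s) =
    subst (_≤ formalBirthday (toGame G)) size≡ (length≤formalBirthday s length≤N)
    where
    length≡ : length ms ≡ pieces (fromSubsets X Y)
    length≡ = length≡pieces s
    size≡ : length ms ≡ faceSize G X Y
    size≡ = trans length≡ (pieces-fromSubsets X Y disj)
    length≤N : length ms ≤ N
    length≤N = subst (_≤ N) (sym length≡) (pieces≤size (fromSubsets X Y))

mainTheorem2 : (G : SPGame) → DimΔ G ((+ formalBirthday (toGame G)) - 1ℤ)
mainTheorem2 G with face-of-size-formalBirthday G
... | X , Y , face , size≡ =
  (X , Y , face , cong (λ m → + m - 1ℤ) size≡) ,
  λ _ _ face′ → ℤ.+-monoˡ-≤ (ℤ.- 1ℤ) (ℤ.+≤+ (faceSize≤formalBirthday G face′))
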